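{- Let $p$ be a prime, and let $\alpha\ge 1$, $r\ge 0$ and $k\ge p^r$ be integers. Assume that $v_p\left(\binom{k}{j}\right)\ge\alpha$ for all $1\le j\le p^r$. Then $v_p(k)\ge \alpha+r$.
   Context: $v_p$ denotes the $p$-adic valuation on integers. -}

module Defs where

open import Data.Nat using (ℕ; _^_)
open import Data.Nat.Divisibility using (_∣_)

-- "v_p(n) ≥ a": the p-adic valuation of n is at least a.
-- Standard meaning (with v_p(0) = ∞): p^a divides n.
ValAtLeast : ℕ → ℕ → ℕ → Set
ValAtLeast p n a = p ^ a ∣ n

-- Write k = m + 1. By induction on r, p^(α + r − 1) ∣ k, so p^r ∣ k because α ≥ 1. The absorption
-- identity (k C p^r) * p^r = k * (m C (p^r − 1)) then gives p^(α + r) ∣ k * (m C (p^r − 1)), and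
-- m C j is prime to p for every j < p^r: passing from j to j + 1 multiplies it by (k − (j + 1))/(j + 1),
-- whose numerator and denominator have the same p-adic valuation since p^r ∣ k and j + 1 < p^r.
module Submission where

open import Defs
open import Data.Nat using (ℕ; _+_; _^_; _≤_)
open import Data.Nat.Primality using (Prime)
open import Data.Nat.Primality using (euclidsLemma; prime⇒nonTrivial; prime⇒nonZero)
open import Data.Nat.Combinatorics using (_C_)

open import Data.Nat.Base
open import Data.Nat.Properties
open import Data.Nat.Combinatorics
  using ([n-k]*d[k+1]≡[k+1]*d[k]; k![n∸k]!∣n!)
open import Data.Nat.Combinatorics.Specification using (nCk≡n!/k![n-k]!)
open import Data.Nat.DivMod using (m/n*n≡m)
open import Algebra.Properties.CommutativeSemigroup *-commutativeSemigroup
  using (x∙yz≈y∙xz; xy∙z≈y∙xz; xy∙z≈zx∙y)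
open import Data.Nat.Divisibility
open import Data.Nat.Induction using (<-rec)
open import Data.Product using (∃-syntax; _,_; proj₁; proj₂)
open import Data.Sum using ([_,_]′)
open import Function using (id; _∘_)
open import Relation.Nullary using (¬_; yes; no; contradiction)
open import Relation.Binary.PropositionalEquality
open ≡-Reasoning

nCk*k![n∸k]!≡n! : ∀ {n k} → k ≤ n → (n C k) * (k ! * (n ∸ k) !) ≡ n !
nCk*k![n∸k]!≡n! {n} {k} k≤n = begin
  (n C k) * d[k]          ≡⟨ cong (_* d[k]) (nCk≡n!/k![n-k]! k≤n) ⟩
  (n ! / d[k]) * d[k]     ≡⟨ m/n*n≡m (k![n∸k]!∣n! k≤n) ⟩
  n !                     ∎
  where
  d[k] = k ! * (n ∸ k) !
  instance _ = k !* (n ∸ k) !≢0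

nC[k+1]*[k+1]≡nCk*[n∸k] : ∀ {n k} → k < n → (n C suc k) * suc k ≡ (n C k) * (n ∸ k)
nC[k+1]*[k+1]≡nCk*[n∸k] {n} {k} k<n = *-cancelʳ-≡ _ _ d[k] {{k !* (n ∸ k) !≢0}} (begin
  (n C suc k) * suc k * d[k]          ≡⟨ *-assoc (n C suc k) (suc k) d[k] ⟩
  (n C suc k) * (suc k * d[k])        ≡⟨ cong ((n C suc k) *_) ([n-k]*d[k+1]≡[k+1]*d[k] k<n) ⟨
  (n C suc k) * ((n ∸ k) * d[k+1])    ≡⟨ x∙yz≈y∙xz (n C suc k) (n ∸ k) d[k+1] ⟩
  (n ∸ k) * ((n C suc k) * d[k+1])    ≡⟨ cong ((n ∸ k) *_) (nCk*k![n∸k]!≡n! k<n) ⟩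
  (n ∸ k) * n !                       ≡⟨ cong ((n ∸ k) *_) (nCk*k![n∸k]!≡n! (<⇒≤ k<n)) ⟨
  (n ∸ k) * ((n C k) * d[k])          ≡⟨ x∙yz≈y∙xz (n ∸ k) (n C k) d[k] ⟩
  (n C k) * ((n ∸ k) * d[k])          ≡⟨ *-assoc (n C k) (n ∸ k) d[k] ⟨
  (n C k) * (n ∸ k) * d[k]            ∎)
  where
  d[k] = k ! * (n ∸ k) !
  d[k+1] = suc k ! * (n ∸ suc k) !

[n+1]C[k+1]*[k+1]≡[n+1]*nCk : ∀ {n k} → k ≤ n → (suc n C suc k) * suc k ≡ suc n * (n C k)
[n+1]C[k+1]*[k+1]≡[n+1]*nCk {n} {k} k≤n = *-cancelʳ-≡ _ _ d[k] {{k !* (n ∸ k) !≢0}} (begin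
  (suc n C suc k) * suc k * d[k]          ≡⟨ *-assoc (suc n C suc k) (suc k) d[k] ⟩
  (suc n C suc k) * (suc k * d[k])        ≡⟨ cong ((suc n C suc k) *_) (*-assoc (suc k) (k !) ((n ∸ k) !)) ⟨
  (suc n C suc k) * (suc k ! * (n ∸ k) !) ≡⟨ nCk*k![n∸k]!≡n! (s≤s k≤n) ⟩
  suc n !                                 ≡⟨ cong (suc n *_) (nCk*k![n∸k]!≡n! k≤n) ⟨
  suc n * ((n C k) * d[k])                ≡⟨ *-assoc (suc n) (n C k) d[k] ⟨
  suc n * (n C k) * d[k]                  ∎)
  where
  d[k] = k ! * (n ∸ k) !

∣m∣n⇒∣m∸n : ∀ {d m n} → d ∣ m → d ∣ n → n ≤ m → d ∣ m ∸ n
∣m∣n⇒∣m∸n {d} d∣m d∣n n≤m = ∣m+n∣m⇒∣n (subst (d ∣_) (sym (m+[n∸m]≡n n≤m)) d∣m) d∣n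

^-monoʳ-∣ : ∀ p {a b} → a ≤ b → p ^ a ∣ p ^ b
^-monoʳ-∣ p {a} {b} a≤b = divides (p ^ (b ∸ a)) (begin
  p ^ b                 ≡⟨ cong (p ^_) (m+[n∸m]≡n a≤b) ⟨
  p ^ (a + (b ∸ a))     ≡⟨ ^-distribˡ-+-* p a (b ∸ a) ⟩
  p ^ a * p ^ (b ∸ a)   ≡⟨ *-comm (p ^ a) (p ^ (b ∸ a)) ⟩
  p ^ (b ∸ a) * p ^ a   ∎)

record HasValuation (p n s : ℕ) : Set where
  constructor factorisation
  field
    cofactor       : ℕ
    n≡p^s*cofactor : n ≡ p ^ s * cofactor
    p∤cofactor     : ¬ p ∣ cofactor

module _ (p : ℕ) .{{p>1 : NonTrivial p}} where

  private instance
    p≢0 : NonZero p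
    p≢0 = nonTrivial⇒nonZero p

  hasValuation⇒p^s∣ : ∀ {n s} → HasValuation p n s → p ^ s ∣ n
  hasValuation⇒p^s∣ {s = s} (factorisation u n≡p^s*u _) =
    divides u (trans n≡p^s*u (*-comm (p ^ s) u))

  hasValuation⇒p^[1+s]∤ : ∀ {n s} → HasValuation p n s → ¬ p ^ suc s ∣ n
  hasValuation⇒p^[1+s]∤ {s = s} (factorisation u n≡p^s*u p∤u) p^[1+s]∣n =
    p∤u (*-cancelˡ-∣ (p ^ s) {{m^n≢0 p s}} (subst₂ _∣_ (*-comm p (p ^ s)) n≡p^s*u p^[1+s]∣n))

  valuation-exists : ∀ n → .{{NonZero n}} → ∃[ s ] HasValuation p n s
  valuation-exists = <-rec _ step
    where
    step : ∀ n → (∀ {m} → m < n → .{{NonZero m}} → ∃[ s ] HasValuation p m s) →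
           .{{NonZero n}} → ∃[ s ] HasValuation p n s
    step n rec with p ∣? n
    ... | no p∤n = 0 , factorisation n (sym (*-identityˡ n)) p∤n
    ... | yes p∣n with rec (quotient-< p∣n) {{quotient≢0 p∣n}}
    ...   | s , factorisation u q≡p^s*u p∤u = suc s , factorisation u (begin
      n                    ≡⟨ m∣n⇒n≡quotient*m p∣n ⟩
      quotient p∣n * p     ≡⟨ cong (_* p) q≡p^s*u ⟩
      p ^ s * u * p        ≡⟨ xy∙z≈zx∙y (p ^ s) u p ⟩
      p * p ^ s * u        ∎) p∤u

  hasValuation⇒<ʳ : ∀ {n s r} .{{_ : NonZero n}} → HasValuation p n s → n < p ^ r → s < r
  hasValuation⇒<ʳ {n} {s} {r} v n<p^r with s <? r
  ... | yes s<r = s<r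
  ... | no s≮r = contradiction
    (∣⇒≤ (∣-trans (^-monoʳ-∣ p (≮⇒≥ s≮r)) (hasValuation⇒p^s∣ v))) (<⇒≱ n<p^r)

  -- p^(s+1) divides k, so it cannot divide k ∸ i without dividing i.
  hasValuation-∸ : ∀ {r k i s} → p ^ r ∣ k → i ≤ k → s < r →
                   HasValuation p i s → HasValuation p (k ∸ i) s
  hasValuation-∸ {r} {k} {i} {s} p^r∣k i≤k s<r vᵢ =
    factorisation (quotient p^s∣k∸i) (m∣n⇒n≡m*quotient p^s∣k∸i) p∤w
    where
    p^s∣k∸i : p ^ s ∣ k ∸ i
    p^s∣k∸i = ∣m∣n⇒∣m∸n (∣-trans (^-monoʳ-∣ p (<⇒≤ s<r)) p^r∣k) (hasValuation⇒p^s∣ vᵢ) i≤k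
    p∤w : ¬ p ∣ quotient p^s∣k∸i
    p∤w p∣w = hasValuation⇒p^[1+s]∤ vᵢ (subst (p ^ suc s ∣_) (m∸[m∸n]≡n i≤k)
      (∣m∣n⇒∣m∸n (∣-trans (^-monoʳ-∣ p s<r) p^r∣k) p^[1+s]∣k∸i (m∸n≤m k i)))
      where
      p^[1+s]∣k∸i : p ^ suc s ∣ k ∸ i
      p^[1+s]∣k∸i = subst₂ _∣_ (*-comm (p ^ s) p) (sym (m∣n⇒n≡m*quotient p^s∣k∸i))
                      (*-monoʳ-∣ (p ^ s) p∣w)

module _ {p : ℕ} (p-prime : Prime p) where

  private instance
    p>1 : NonTrivial p
    p>1 = prime⇒nonTrivial p-prime
    p≢0 : NonZero p
    p≢0 = prime⇒nonZero p-prime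

  p∣-transfer : ∀ {a b x y s} → a * x ≡ b * y →
                HasValuation p x s → HasValuation p y s → p ∣ a → p ∣ b
  p∣-transfer {a} {b} {x} {y} {s} ax≡by
              (factorisation u x≡p^s*u _) (factorisation w y≡p^s*w p∤w) p∣a =
    [ id , (λ p∣w → contradiction p∣w p∤w) ]′
      (euclidsLemma b w p-prime (subst (p ∣_) au≡bw (∣m⇒∣m*n u p∣a)))
    where
    au≡bw : a * u ≡ b * w
    au≡bw = *-cancelˡ-≡ _ _ (p ^ s) {{m^n≢0 p s}} (begin
      p ^ s * (a * u)   ≡⟨ x∙yz≈y∙xz (p ^ s) a u ⟩
      a * (p ^ s * u)   ≡⟨ cong (a *_) x≡p^s*u ⟨
      a * x             ≡⟨ ax≡by ⟩
      b * y             ≡⟨ cong (b *_) y≡p^s*w ⟩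
      b * (p ^ s * w)   ≡⟨ x∙yz≈y∙xz b (p ^ s) w ⟩
      p ^ s * (b * w)   ∎)

  p^e∣m*c⇒p^e∣m : ∀ {m c} e → ¬ p ∣ c → p ^ e ∣ m * c → p ^ e ∣ m
  p^e∣m*c⇒p^e∣m {m} zero _ _ = 1∣ m
  p^e∣m*c⇒p^e∣m {m} {c} (suc e) p∤c p^[1+e]∣mc
    with divides t m≡t*p^e ← p^e∣m*c⇒p^e∣m e p∤c (m*n∣⇒n∣ p (p ^ e) p^[1+e]∣mc) =
    subst (p ^ suc e ∣_) (sym m≡t*p^e) (*-monoˡ-∣ (p ^ e) p∣t)
    where
    p∣tc : p ∣ t * c
    p∣tc = *-cancelˡ-∣ (p ^ e) {{m^n≢0 p e}}
      (subst₂ _∣_ (*-comm p (p ^ e)) (trans (cong (_* c) m≡t*p^e) (xy∙z≈y∙xz t (p ^ e) c)) p^[1+e]∣mc)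
    p∣t : p ∣ t
    p∣t = [ id , (λ p∣c → contradiction p∣c p∤c) ]′ (euclidsLemma t c p-prime p∣tc)

  p∤mCj : ∀ {r m j} → p ^ r ∣ suc m → j < p ^ r → ¬ p ∣ (m C j)
  p∤mCj {j = zero} _ _ = nonTrivial⇒≢1 ∘ ∣1⇒≡1
  p∤mCj {r} {m} {suc j} p^r∣m+1 j+1<p^r =
    p∤mCj {r} p^r∣m+1 (<⇒≤ j+1<p^r) ∘ p∣-transfer (nC[k+1]*[k+1]≡nCk*[n∸k] j<m) v[j+1] v[m∸j]
    where
    j<m : j < m
    j<m = s<s⁻¹ (<-≤-trans j+1<p^r (∣⇒≤ p^r∣m+1))
    s = proj₁ (valuation-exists p (suc j))
    v[j+1] : HasValuation p (suc j) s
    v[j+1] = proj₂ (valuation-exists p (suc j))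
    v[m∸j] : HasValuation p (m ∸ j) s
    v[m∸j] = hasValuation-∸ p {r} p^r∣m+1 (s≤s (<⇒≤ j<m))
               (hasValuation⇒<ʳ p {r = r} v[j+1] j+1<p^r) v[j+1]

  p^[α+r]∣k-of-binomial : ∀ {α r k} → p ^ r ∣ k → p ^ α ∣ (k C p ^ r) → p ^ (α + r) ∣ k
  p^[α+r]∣k-of-binomial {α} {r} {zero} _ _ = (p ^ (α + r)) ∣0
  p^[α+r]∣k-of-binomial {α} {r} {suc m} p^r∣k p^α∣kCp^r =
    p^e∣m*c⇒p^e∣m (α + r) (p∤mCj {r} p^r∣k (m≤pred[n]⇒suc[m]≤n ≤-refl))
      (subst₂ _∣_ (sym (^-distribˡ-+-* p α r)) absorption (*-monoˡ-∣ (p ^ r) p^α∣kCp^r))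
    where
    instance _ = m^n≢0 p r
    absorption : (suc m C p ^ r) * p ^ r ≡ suc m * (m C pred (p ^ r))
    absorption = subst (λ q → (suc m C q) * q ≡ suc m * (m C pred (p ^ r))) (suc-pred (p ^ r))
      ([n+1]C[k+1]*[k+1]≡[n+1]*nCk (pred-mono-≤ (∣⇒≤ p^r∣k)))

  p^[α+r]∣k-of-binomials : ∀ {α k} r → 1 ≤ α →
    (∀ j → 1 ≤ j → j ≤ p ^ r → p ^ α ∣ (k C j)) → p ^ (α + r) ∣ k
  p^[α+r]∣k-of-binomials {α} zero _ h = p^[α+r]∣k-of-binomial {α} {0} (1∣ _) (h 1 ≤-refl ≤-refl)
  p^[α+r]∣k-of-binomials {α} {k} (suc r) 1≤α h =
    p^[α+r]∣k-of-binomial {α} {suc r} (∣-trans (^-monoʳ-∣ p (+-monoˡ-≤ r 1≤α)) p^[α+r]∣k-ih)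
      (h (p ^ suc r) (m^n>0 p (suc r)) ≤-refl)
    where
    p^[α+r]∣k-ih : p ^ (α + r) ∣ k
    p^[α+r]∣k-ih = p^[α+r]∣k-of-binomials r 1≤α
      (λ j 1≤j j≤p^r → h j 1≤j (≤-trans j≤p^r (^-monoʳ-≤ p (n≤1+n r))))

lemma2p3 : (p α r k : ℕ) → Prime p → 1 ≤ α → p ^ r ≤ k →
    ((j : ℕ) → 1 ≤ j → j ≤ p ^ r → ValAtLeast p (k C j) α) →
    ValAtLeast p k (α + r)
lemma2p3 p α r k p-prime 1≤α _ = p^[α+r]∣k-of-binomials p-prime r 1≤α
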